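{- For every environment $\Gamma$ (finite multiset of formulas), if $\vdash \Gamma$ is derivable in classical linear logic (CLL), then $\vdash \Gamma$ (the hyperenvironment consisting of the single environment $\Gamma$) is derivable in the type-only HCP sequent system.
   Context: Formulas: $A,B ::= A\otimes B \mid A ⅋ B \mid A\oplus B \mid A\&B \mid 1\mid\bot\mid ?A\mid !A$, with involutive duality $(A\otimes B)^\perp = A^\perp ⅋ B^\perp$, $(A\oplus B)^\perp = A^\perp \& B^\perp$, $1^\perp = \bot$, $(?A)^\perp = !A^\perp$ (and symmetrically). Environments $\Gamma,\Delta$ are finite unordered multisets of formulas; $?\Gamma$ denotes one whose formulas all have the form $?B$. CLL is Girard's one-sided sequent calculus (without Mix): $\vdash A^\perp, A$; Cut: from $\vdash\Gamma,A$ and $\vdash\Delta,A^\perp$ infer $\vdash\Gamma,\Delta$; $\otimes$: from $\vdash\Gamma,A$ and $\vdash\Delta,B$ infer $\vdash\Gamma,\Delta,A\otimes B$; ⅋: from $\vdash \Gamma,A,B$ infer $\vdash\Gamma,A⅋B$; $\vdash 1$; $\bot$: from $\vdash\Gamma$ infer $\vdash\Gamma,\bot$; $\oplus_i$: from $\vdash\Gamma,A_i$ infer $\vdash\Gamma,A_1\oplus A_2$; $\&$: from $\vdash\Gamma,A$ and $\vdash\Gamma,B$ infer $\vdash\Gamma,A\&B$; $!$: from $\vdash ?\Gamma,A$ infer $\vdash ?\Gamma,!A$; $?$: from $\vdash\Gamma,A$ infer $\vdash\Gamma,?A$; weakening: from $\vdash\Gamma$ infer $\vdash\Gamma,?A$;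 contraction: from $\vdash\Gamma,?A,?A$ infer $\vdash\Gamma,?A$. A hyperenvironment $\mathcal{G}=\Gamma_1\mid\cdots\mid\Gamma_n$ is an unordered collection of environments ($\varnothing$ the empty one). The type-only HCP system derives $\vdash \mathcal{G}$ by: (Ax) $\vdash A^\perp,A$; (H-Cut) from $\vdash \mathcal{G}\mid\Gamma,A\mid\Delta,A^\perp$ infer $\vdash\mathcal{G}\mid\Gamma,\Delta$; (H-Mix) from $\vdash\mathcal{G}$ and $\vdash\mathcal{H}$ infer $\vdash\mathcal{G}\mid\mathcal{H}$; (H-Mix$_0$) $\vdash\varnothing$; ($\otimes$) from $\vdash\mathcal{G}\mid\Gamma,A\mid\Delta,B$ infer $\vdash\mathcal{G}\mid\Gamma,\Delta,A\otimes B$; ($1$) from $\vdash\mathcal{G}$ infer $\vdash\mathcal{G}\mid 1$; (⅋) from $\vdash\mathcal{G}\mid\Gamma,A,B$ infer $\vdash\mathcal{G}\mid\Gamma,A⅋B$; ($\bot$) from $\vdash\mathcal{G}\mid\Gamma$ infer $\vdash\mathcal{G}\mid\Gamma,\bot$; ($\oplus_i$) from $\vdash\mathcal{G}\mid\Gamma,A_i$ infer $\vdash\mathcal{G}\mid\Gamma,A_1\oplus A_2$; ($\&$) from $\vdash\Gamma,A$ and $\vdash\Gamma,B$ infer $\vdash\Gamma,A\&B$; ($!$) from $\vdash ?\Gamma,A$ infer $\vdash ?\Gamma,!A$; ($?$) from $\vdash\mathcal{G}\mid\Gamma,A$ infer $\vdash\mathcal{G}\mid\Gamma,?A$; (W)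 from $\vdash\mathcal{G}\mid\Gamma$ infer $\vdash\mathcal{G}\mid\Gamma,?A$; (C) from $\vdash\mathcal{G}\mid\Gamma,?A,?A$ infer $\vdash\mathcal{G}\mid\Gamma,?A$. -}

module Defs where

open import Data.Nat using (ℕ)
open import Data.List using (List; []; _∷_; _++_; [_]; map)
open import Data.List.Relation.Binary.Permutation.Propositional using (_↭_)
open import Data.List.Relation.Unary.All using (All)
open import Relation.Binary.PropositionalEquality using (_≡_)
open import Data.Product using (∃)

data Formula : Set where
  atom  : ℕ → Formula
  atom⊥ : ℕ → Formula
  _⊗_ _⅋_ _⊕_ _&_ : Formula → Formula → Formula
  𝟏 ⊥̂ : Formula
  ‼_ ⁇_ : Formula → Formula

infixr 6 _⊗_ _⅋_ _⊕_ _&_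

_^⊥ : Formula → Formula
atom x ^⊥ = atom⊥ x
atom⊥ x ^⊥ = atom x
(A ⊗ B) ^⊥ = (A ^⊥) ⅋ (B ^⊥)
(A ⅋ B) ^⊥ = (A ^⊥) ⊗ (B ^⊥)
(A ⊕ B) ^⊥ = (A ^⊥) & (B ^⊥)
(A & B) ^⊥ = (A ^⊥) ⊕ (B ^⊥)
𝟏 ^⊥ = ⊥̂
⊥̂ ^⊥ = 𝟏
(‼ A) ^⊥ = ⁇ (A ^⊥)
(⁇ A) ^⊥ = ‼ (A ^⊥)

-- Environments: finite multisets, represented as lists up to permutation
-- (the exchange rules below make derivability permutation-invariant).
Env : Set
Env = List Formula

data IsWhyNot : Formula → Set where
  whyNot : ∀ A → IsWhyNot (⁇ A)

AllWhyNot : Env → Set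
AllWhyNot = All IsWhyNot

data CLL : Env → Set where
  exch : ∀ {Γ Δ} → Γ ↭ Δ → CLL Γ → CLL Δ
  ax   : ∀ A → CLL (A ^⊥ ∷ A ∷ [])
  cut  : ∀ {Γ Δ} A → CLL (A ∷ Γ) → CLL (A ^⊥ ∷ Δ) → CLL (Γ ++ Δ)
  ⊗R   : ∀ {Γ Δ A B} → CLL (A ∷ Γ) → CLL (B ∷ Δ) → CLL ((A ⊗ B) ∷ Γ ++ Δ)
  ⅋R   : ∀ {Γ A B} → CLL (A ∷ B ∷ Γ) → CLL ((A ⅋ B) ∷ Γ)
  𝟏R   : CLL (𝟏 ∷ [])
  ⊥R   : ∀ {Γ} → CLL Γ → CLL (⊥̂ ∷ Γ)
  ⊕₁R  : ∀ {Γ A B} → CLL (A ∷ Γ) → CLL ((A ⊕ B) ∷ Γ)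
  ⊕₂R  : ∀ {Γ A B} → CLL (B ∷ Γ) → CLL ((A ⊕ B) ∷ Γ)
  &R   : ∀ {Γ A B} → CLL (A ∷ Γ) → CLL (B ∷ Γ) → CLL ((A & B) ∷ Γ)
  !R   : ∀ {Γ A} → AllWhyNot Γ → CLL (A ∷ Γ) → CLL ((‼ A) ∷ Γ)
  ?R   : ∀ {Γ A} → CLL (A ∷ Γ) → CLL ((⁇ A) ∷ Γ)
  weak : ∀ {Γ A} → CLL Γ → CLL ((⁇ A) ∷ Γ)
  contr : ∀ {Γ A} → CLL ((⁇ A) ∷ (⁇ A) ∷ Γ) → CLL ((⁇ A) ∷ Γ)

-- Hyperenvironments: finite unordered collections of environments,
-- represented as lists of environments; exchange is allowed both
-- between environments and inside each environment.
HEnv : Set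
HEnv = List Env

data _∼ᴴ_ : HEnv → HEnv → Set where
  outer : ∀ {𝒢 ℋ} → 𝒢 ↭ ℋ → 𝒢 ∼ᴴ ℋ
  inner : ∀ {𝒢 Γ Δ} → Γ ↭ Δ → (Γ ∷ 𝒢) ∼ᴴ (Δ ∷ 𝒢)

data HCP : HEnv → Set where
  exch  : ∀ {𝒢 ℋ} → 𝒢 ∼ᴴ ℋ → HCP 𝒢 → HCP ℋ
  ax    : ∀ A → HCP ((A ^⊥ ∷ A ∷ []) ∷ [])
  hcut  : ∀ {𝒢 Γ Δ} A → HCP ((A ∷ Γ) ∷ (A ^⊥ ∷ Δ) ∷ 𝒢) → HCP ((Γ ++ Δ) ∷ 𝒢)
  hmix  : ∀ {𝒢 ℋ} → HCP 𝒢 → HCP ℋ → HCP (𝒢 ++ ℋ)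
  hmix₀ : HCP []
  ⊗R    : ∀ {𝒢 Γ Δ A B} → HCP ((A ∷ Γ) ∷ (B ∷ Δ) ∷ 𝒢) → HCP (((A ⊗ B) ∷ Γ ++ Δ) ∷ 𝒢)
  𝟏R    : ∀ {𝒢} → HCP 𝒢 → HCP ((𝟏 ∷ []) ∷ 𝒢)
  ⅋R    : ∀ {𝒢 Γ A B} → HCP ((A ∷ B ∷ Γ) ∷ 𝒢) → HCP (((A ⅋ B) ∷ Γ) ∷ 𝒢)
  ⊥R    : ∀ {𝒢 Γ} → HCP (Γ ∷ 𝒢) → HCP ((⊥̂ ∷ Γ) ∷ 𝒢)
  ⊕₁R   : ∀ {𝒢 Γ A B} → HCP ((A ∷ Γ) ∷ 𝒢) → HCP (((A ⊕ B) ∷ Γ) ∷ 𝒢)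
  ⊕₂R   : ∀ {𝒢 Γ A B} → HCP ((B ∷ Γ) ∷ 𝒢) → HCP (((A ⊕ B) ∷ Γ) ∷ 𝒢)
  &R    : ∀ {Γ A B} → HCP ((A ∷ Γ) ∷ []) → HCP ((B ∷ Γ) ∷ []) → HCP (((A & B) ∷ Γ) ∷ [])
  !R    : ∀ {Γ A} → AllWhyNot Γ → HCP ((A ∷ Γ) ∷ []) → HCP (((‼ A) ∷ Γ) ∷ [])
  ?R    : ∀ {𝒢 Γ A} → HCP ((A ∷ Γ) ∷ 𝒢) → HCP (((⁇ A) ∷ Γ) ∷ 𝒢)
  weak  : ∀ {𝒢 Γ A} → HCP (Γ ∷ 𝒢) → HCP (((⁇ A) ∷ Γ) ∷ 𝒢)
  contr : ∀ {𝒢 Γ A} → HCP (((⁇ A) ∷ (⁇ A) ∷ Γ) ∷ 𝒢) → HCP (((⁇ A) ∷ Γ) ∷ 𝒢)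

module Submission where

-- The two binary rules that
-- combine independent premises, Cut and ⊗, are the interesting cases: HCP
-- has no such rules on separate derivations, so the two translated premises
-- are first placed side by side with H-Mix (lemma `juxtapose`), and then
-- H-Cut or the hypersequent ⊗ rule merges the two environments into one.

open import Defs
open import Data.List using (List; []; _∷_)

juxtapose : ∀ {Γ Δ} → HCP (Γ ∷ []) → HCP (Δ ∷ []) → HCP (Γ ∷ Δ ∷ [])
juxtapose d e = hmix d e

embed : ∀ {Γ} → CLL Γ → HCP (Γ ∷ [])
embed (exch p d)  = exch (inner p) (embed d)
embed (ax A)      = ax A
embed (cut A d e) = hcut A (juxtapose (embed d) (embed e))
embed (⊗R d e)    = ⊗R (juxtapose (embed d) (embed e))
embed (⅋R d)      = ⅋R (embed d)
embed 𝟏R          = 𝟏R hmix₀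
embed (⊥R d)      = ⊥R (embed d)
embed (⊕₁R d)     = ⊕₁R (embed d)
embed (⊕₂R d)     = ⊕₂R (embed d)
embed (&R d e)    = &R (embed d) (embed e)
embed (!R w d)    = !R w (embed d)
embed (?R d)      = ?R (embed d)
embed (weak d)    = weak (embed d)
embed (contr d)   = contr (embed d)

theorem2p5 : (Γ : Env) → CLL Γ → HCP (Γ ∷ [])
theorem2p5 Γ = embed
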